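{- Let $\mathcal{A}$ be a finite structure with domain $A$, let $U,X\subseteq A$, and suppose $\mathcal{A}$ has a surjective hyper-endomorphism that is $U$-surjective and $X$-total. Let $\widetilde{\mathcal{A}}$ be the substructure of $\mathcal{A}$ induced by $U\cup X$. Then (i) $\mathcal{A}$ and $\widetilde{\mathcal{A}}$ satisfy the same sentences of $\{\exists,\forall,\wedge,\vee\}\text{ -FO}$, and (ii) $\widetilde{\mathcal{A}}$ has $\forall U$-$\exists X$-relativisation.
   Context: Structures are finite relational structures with nonempty domain. $\{\exists,\forall,\wedge,\vee\}\text{ -FO}$ is the set of first-order sentences built from relational atoms (no equality, no negation) using $\wedge,\vee,\exists,\forall$. A surjective hyper-endomorphism of $\mathcal{A}$ is a map $f$ from $A$ to the power set of $A$ with $f(a)\neq\emptyset$ for all $a$, $\bigcup_a f(a)=A$, and such that for every relation $R$ of arity $i$, $R(a_1,\dots,a_i)$ in $\mathcal{A}$ implies $R(b_1,\dots,b_i)$ in $\mathcal{A}$ for all $b_j\in f(a_j)$. $f$ is $U$-surjective if $\bigcup_{u\in U}f(u)=A$ and $X$-total if $f(a)\cap X\neq\emptyset$ for all $a\in A$. A structure $\mathcal{B}$ with $U,X\subseteq B$ has $\forall U$-$\exists X$-relativisation if for every sentence $\varphi$ of $\{\exists,\forall,\wedge,\vee\}\text{ -FO}$ the statements $\mathcal{B}\models\varphi$, $\mathcal{B}\models\varphi$ with all universal quantifiers relativised to $U$, $\mathcal{B}\models\varphi$ with all existential quantifiers relativised to $X$, and $\mathcal{B}\models\varphi$ with both relativisations,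 are all equivalent. -}

module Defs where

open import Data.Nat using (ℕ; suc)
open import Data.Fin using (Fin)
open import Data.Fin.Subset using (Subset; _∈_; _∪_)
open import Data.Vec using (Vec; lookup; map; []; _∷_)
open import Data.Product using (Σ; ∃; _×_; _,_; proj₁)
open import Data.Sum using (_⊎_)
open import Data.Unit using (⊤)
open import Function.Bundles using (_⇔_)

record Signature : Set₁ where
  field
    Sym : Set
    ar  : Sym → ℕ
open Signature public

Structure : Signature → Set → Set₁
Structure σ D = (R : Sym σ) → Vec D (ar σ R) → Set

-- Formulas of {∃,∀,∧,∨}-FO with k free variables (de Bruijn indices);
-- only relational atoms, no equality, no negation.
data Formula (σ : Signature) (k : ℕ) : Set where
  atom : (R : Sym σ) → Vec (Fin k) (ar σ R) → Formula σ k
  _∧ᶠ_ : Formula σ k → Formula σ k → Formula σ k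
  _∨ᶠ_ : Formula σ k → Formula σ k → Formula σ k
  ∃ᶠ   : Formula σ (suc k) → Formula σ k
  ∀ᶠ   : Formula σ (suc k) → Formula σ k

Sentence : Signature → Set
Sentence σ = Formula σ 0

-- Satisfaction, with universal quantifiers relativised to PU and existential
-- quantifiers relativised to PX (take PU = PX = everything for plain satisfaction).
Sat : {σ : Signature} {D : Set} → Structure σ D → (PU PX : D → Set) →
      {k : ℕ} → Vec D k → Formula σ k → Set
Sat 𝓑 PU PX ρ (atom R xs) = 𝓑 R (map (lookup ρ) xs)
Sat 𝓑 PU PX ρ (φ ∧ᶠ ψ) = Sat 𝓑 PU PX ρ φ × Sat 𝓑 PU PX ρ ψ
Sat 𝓑 PU PX ρ (φ ∨ᶠ ψ) = Sat 𝓑 PU PX ρ φ ⊎ Sat 𝓑 PU PX ρ ψ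
Sat 𝓑 PU PX ρ (∃ᶠ φ) = Σ _ λ d → PX d × Sat 𝓑 PU PX (d ∷ ρ) φ
Sat 𝓑 PU PX ρ (∀ᶠ φ) = ∀ d → PU d → Sat 𝓑 PU PX (d ∷ ρ) φ

everything : {D : Set} → D → Set
everything _ = ⊤

_⊨_ : {σ : Signature} {D : Set} → Structure σ D → Sentence σ → Set
𝓑 ⊨ φ = Sat 𝓑 everything everything [] φ

HasRelativisation : {σ : Signature} {D : Set} → Structure σ D → (U X : D → Set) → Set
HasRelativisation 𝓑 U X = ∀ φ →
  ((𝓑 ⊨ φ) ⇔ Sat 𝓑 U everything [] φ) ×
  ((𝓑 ⊨ φ) ⇔ Sat 𝓑 everything X [] φ) ×
  ((𝓑 ⊨ φ) ⇔ Sat 𝓑 U X [] φ)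

module _ {σ : Signature} {n : ℕ} (𝓐 : Structure σ (Fin n)) where

  IsSurjectiveHyperEndomorphism : (Fin n → Subset n) → Set
  IsSurjectiveHyperEndomorphism f =
    (∀ a → ∃ λ b → b ∈ f a) ×
    (∀ b → ∃ λ a → b ∈ f a) ×
    (∀ (R : Sym σ) (as bs : Vec (Fin n) (ar σ R)) → 𝓐 R as →
       (∀ i → lookup bs i ∈ f (lookup as i)) → 𝓐 R bs)

IsUSurjective : {n : ℕ} → Subset n → (Fin n → Subset n) → Set
IsUSurjective U f = ∀ b → ∃ λ u → u ∈ U × b ∈ f u

IsXTotal : {n : ℕ} → Subset n → (Fin n → Subset n) → Set
IsXTotal X f = ∀ a → ∃ λ x → x ∈ X × x ∈ f a

Induced : {σ : Signature} {n : ℕ} → Structure σ (Fin n) → (S : Subset n) →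
          Structure σ (Σ (Fin n) λ a → a ∈ S)
Induced 𝓐 S R xs = 𝓐 R (map proj₁ xs)

-- A U-surjective, X-total hyper-endomorphism f turns satisfaction with universal
-- quantifiers relativised to U into satisfaction with existential quantifiers
-- relativised to X: a universal witness b is pulled back to some u ∈ U with b ∈ f u,
-- an existential witness a is pushed to some x ∈ X ∩ f a, and atoms survive because f
-- is a hyper-endomorphism. All witnesses involved lie in U ∪ X, so the same works
-- starting from Ã, and an ∃X-statement about 𝓐 is one about Ã. Hence on Ã the weakest
-- of the four readings implies the strongest, which squeezes the other two in between.
module Submission where

open import Defs
open import Data.Nat using (ℕ; suc)
open import Data.Fin using (Fin)
open import Data.Fin.Subset using (Subset; _∈_; _∪_)
open import Data.Fin.Subset.Properties using (x∈p∪q⁺)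
open import Data.Product using (∃; _×_; _,_; proj₁)
open import Data.Sum using (inj₁; inj₂)
open import Data.Unit using (tt)
open import Data.Vec using (Vec; lookup; map; []; _∷_)
open import Data.Vec.Relation.Binary.Pointwise.Inductive as Pointwise
  using (Pointwise; []; _∷_; Pointwise-≡⇒≡)
open import Function.Base using (_∘_)
open import Function.Bundles using (_⇔_; mk⇔)
open import Relation.Binary.PropositionalEquality using (_≡_; refl; sym; subst)
open import Relation.Unary using (Pred; _⊆_)

module _ {A B : Set} {R : A → B → Set} where

  map-lookup⁺ : ∀ {k m} {ρ : Vec A k} {ρ′ : Vec B k} → Pointwise R ρ ρ′ →
                (xs : Vec (Fin k) m) → Pointwise R (map (lookup ρ) xs) (map (lookup ρ′) xs)
  map-lookup⁺ ρ∼ρ′ []       = []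
  map-lookup⁺ ρ∼ρ′ (x ∷ xs) = Pointwise.lookup ρ∼ρ′ x ∷ map-lookup⁺ ρ∼ρ′ xs

module _ {A C B : Set} {R : A → B → Set} {f : C → A} where

  mapˡ⁺ : ∀ {m} {xs : Vec C m} {ys : Vec B m} →
          Pointwise (λ x y → R (f x) y) xs ys → Pointwise R (map f xs) ys
  mapˡ⁺ []            = []
  mapˡ⁺ (x∼y ∷ xs∼ys) = x∼y ∷ mapˡ⁺ xs∼ys

record Transfer {σ : Signature} {D E : Set}
                (𝓑 : Structure σ D) (PU PX : Pred D _)
                (𝓒 : Structure σ E) (QU QX : Pred E _)
                (H : D → E → Set) : Set where
  field
    preserves-atoms : ∀ R {as bs} → Pointwise H as bs → 𝓑 R as → 𝓒 R bs
    back            : ∀ e → QU e → ∃ λ d → PU d × H d e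
    forth           : ∀ d → PX d → ∃ λ e → QX e × H d e

module _ {σ : Signature} {D E : Set} {𝓑 : Structure σ D} {𝓒 : Structure σ E}
         {PU PX : Pred D _} {QU QX : Pred E _} {H : D → E → Set}
         (T : Transfer 𝓑 PU PX 𝓒 QU QX H) where

  open Transfer T

  transfer : ∀ {k} {ρ : Vec D k} {ρ′ : Vec E k} → Pointwise H ρ ρ′ →
             (φ : Formula σ k) → Sat 𝓑 PU PX ρ φ → Sat 𝓒 QU QX ρ′ φ
  transfer ρ∼ρ′ (atom R xs) s        = preserves-atoms R (map-lookup⁺ ρ∼ρ′ xs) s
  transfer ρ∼ρ′ (φ ∧ᶠ ψ) (s , t)     = transfer ρ∼ρ′ φ s , transfer ρ∼ρ′ ψ t
  transfer ρ∼ρ′ (φ ∨ᶠ ψ) (inj₁ s)    = inj₁ (transfer ρ∼ρ′ φ s)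
  transfer ρ∼ρ′ (φ ∨ᶠ ψ) (inj₂ t)    = inj₂ (transfer ρ∼ρ′ ψ t)
  transfer ρ∼ρ′ (∃ᶠ φ) (d , pd , s)  =
    let e , qe , d∼e = forth d pd in e , qe , transfer (d∼e ∷ ρ∼ρ′) φ s
  transfer ρ∼ρ′ (∀ᶠ φ) s e qe        =
    let d , pd , d∼e = back e qe in transfer (d∼e ∷ ρ∼ρ′) φ (s d pd)

  transfer-sentence : (φ : Sentence σ) → Sat 𝓑 PU PX [] φ → Sat 𝓒 QU QX [] φ
  transfer-sentence = transfer []

module _ {σ : Signature} {D : Set} (𝓑 : Structure σ D) where

  Sat-mono : {PU PX QU QX : Pred D _} → QU ⊆ PU → PX ⊆ QX →
             (φ : Sentence σ) → Sat 𝓑 PU PX [] φ → Sat 𝓑 QU QX [] φ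
  Sat-mono QU⊆PU PX⊆QX = transfer-sentence record
    { preserves-atoms = λ R as≡bs → subst (𝓑 R) (Pointwise-≡⇒≡ as≡bs)
    ; back            = λ e qe → e , QU⊆PU qe , refl
    ; forth           = λ d pd → d , PX⊆QX pd , refl
    }

  module _ {U X : Pred D _}
           (weakest⇒strongest : ∀ φ → Sat 𝓑 U everything [] φ → Sat 𝓑 everything X [] φ) where

    ⊨⇔relativised : {QU QX : Pred D _} → U ⊆ QU → X ⊆ QX →
                    ∀ φ → (𝓑 ⊨ φ) ⇔ Sat 𝓑 QU QX [] φ
    ⊨⇔relativised U⊆QU X⊆QX φ = mk⇔
      (λ s → Sat-mono (λ _ → tt) X⊆QX φ
               (weakest⇒strongest φ (Sat-mono (λ _ → tt) (λ _ → tt) φ s)))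
      (λ s → Sat-mono (λ _ → tt) (λ _ → tt) φ
               (weakest⇒strongest φ (Sat-mono U⊆QU (λ _ → tt) φ s)))

    hasRelativisation : HasRelativisation 𝓑 U X
    hasRelativisation φ =
      ⊨⇔relativised (λ u → u) (λ _ → tt) φ ,
      ⊨⇔relativised (λ _ → tt) (λ x → x) φ ,
      ⊨⇔relativised (λ u → u) (λ x → x) φ

module _ {σ : Signature} {n : ℕ} {𝓐 : Structure σ (Fin n)} where

  hyperEndomorphism-transfer : ∀ {f U X} → IsSurjectiveHyperEndomorphism 𝓐 f →
    IsUSurjective U f → IsXTotal X f →
    Transfer 𝓐 (_∈ U) everything 𝓐 everything (_∈ X) (λ a b → b ∈ f a)
  hyperEndomorphism-transfer (_ , _ , hom) U-surjective X-total = record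
    { preserves-atoms = λ R as∼bs s → hom R _ _ s (Pointwise.lookup as∼bs)
    ; back            = λ b _ → U-surjective b
    ; forth           = λ a _ → X-total a
    }

  restrict-transfer : ∀ {S : Subset n} {E} {𝓒 : Structure σ E}
    {PU PX : Pred (Fin n) _} {QU QX : Pred E _} {H : Fin n → E → Set} →
    (∀ {a} → PU a → a ∈ S) → Transfer 𝓐 PU PX 𝓒 QU QX H →
    Transfer (Induced 𝓐 S) (λ d → PU (proj₁ d)) (λ d → PX (proj₁ d)) 𝓒 QU QX (λ d → H (proj₁ d))
  restrict-transfer PU⊆S T = record
    { preserves-atoms = λ R ds∼bs → preserves-atoms R (mapˡ⁺ ds∼bs)
    ; back            = λ e qe → let a , pa , a∼e = back e qe in (a , PU⊆S pa) , pa , a∼e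
    ; forth           = λ d pd → forth (proj₁ d) pd
    }
    where open Transfer T

  inclusion-transfer : ∀ {S : Subset n} {PX : Pred (Fin n) _} → (∀ {a} → PX a → a ∈ S) →
    Transfer 𝓐 everything PX (Induced 𝓐 S) everything (λ d → PX (proj₁ d)) (λ a d → proj₁ d ≡ a)
  inclusion-transfer PX⊆S = record
    { preserves-atoms = λ R as∼ds s →
        subst (𝓐 R) (sym (Pointwise-≡⇒≡ (mapˡ⁺ (Pointwise.sym (λ p → p) as∼ds)))) s
    ; back            = λ d _ → proj₁ d , tt , refl
    ; forth           = λ a pa → (a , PX⊆S pa) , pa , refl
    }

corollary3 : (σ : Signature) (n : ℕ) (𝓐 : Structure σ (Fin (suc n)))
    (U X : Subset (suc n)) →
    (∃ λ f → IsSurjectiveHyperEndomorphism 𝓐 f × IsUSurjective U f × IsXTotal X f) →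
    (∀ (φ : Sentence σ) → (𝓐 ⊨ φ) ⇔ (Induced 𝓐 (U ∪ X) ⊨ φ)) ×
    HasRelativisation (Induced 𝓐 (U ∪ X)) (λ a → proj₁ a ∈ U) (λ a → proj₁ a ∈ X)
corollary3 σ n 𝓐 U X (f , endo , U-surjective , X-total) =
  𝓐⇔Ã , hasRelativisation Ã (λ φ → ι φ ∘ endoÃ φ)
  where
  Ã = Induced 𝓐 (U ∪ X)
  endo𝓐 : ∀ φ → Sat 𝓐 (_∈ U) everything [] φ → Sat 𝓐 everything (_∈ X) [] φ
  endo𝓐 = transfer-sentence (hyperEndomorphism-transfer endo U-surjective X-total)
  endoÃ : ∀ φ → Sat Ã (λ a → proj₁ a ∈ U) everything [] φ → Sat 𝓐 everything (_∈ X) [] φ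
  endoÃ = transfer-sentence (restrict-transfer (λ u → x∈p∪q⁺ (inj₁ u))
                              (hyperEndomorphism-transfer endo U-surjective X-total))
  ι : ∀ φ → Sat 𝓐 everything (_∈ X) [] φ → Sat Ã everything (λ a → proj₁ a ∈ X) [] φ
  ι = transfer-sentence (inclusion-transfer (λ x → x∈p∪q⁺ (inj₂ x)))
  𝓐⇔Ã : ∀ φ → (𝓐 ⊨ φ) ⇔ (Ã ⊨ φ)
  𝓐⇔Ã φ = mk⇔
    (λ s → weaken Ã φ (ι φ (endo𝓐 φ (weaken 𝓐 φ s))))
    (λ s → weaken 𝓐 φ (endoÃ φ (weaken Ã φ s)))
    where
    weaken : ∀ {D} (𝓑 : Structure σ D) {PX QU : Pred D _} φ →
             Sat 𝓑 everything PX [] φ → Sat 𝓑 QU everything [] φ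
    weaken 𝓑 = Sat-mono 𝓑 (λ _ → tt) (λ _ → tt)
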